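{- There is an absolute constant $C>0$ such that for every finite hypergraph $\mathcal{H}=(V,\mathcal{E})$ with $|V|=n$ (all hyperedges nonempty), $ch_{CF}(\mathcal{H}) \le C\,\big(ch^*_{CF}(\mathcal{H}) + \ln n\big)$; that is, $ch_{CF}(\mathcal{H}) = O(ch^*_{CF}(\mathcal{H}) + \ln n)$.
   Context: For a hypergraph $\mathcal{H}=(V,\mathcal{E})$, a list assignment $\mathcal{L}=\{L_v : v\in V\}$ assigns to each vertex a set $L_v$ of admissible colors; it is a $k$-assignment if $|L_v|=k$ for all $v$. An $\mathcal{L}$-CF$^*$-coloring is a map $f: V'\to\bigcup_{v\in V'}L_v$ for some $V'\subseteq V$ with $f(v)\in L_v$ for all $v\in V'$, such that every hyperedge $E\in\mathcal{E}$ contains a colored vertex whose color differs from the color of every other (colored) vertex of $E$. If $V'=V$ it is an $\mathcal{L}$-CF-coloring. $\mathcal{H}$ is $k$-CF$^*$-choosable (resp. $k$-CF-choosable) if it admits an $\mathcal{L}$-CF$^*$-coloring (resp. $\mathcal{L}$-CF-coloring) for every $k$-assignment $\mathcal{L}$. The CF$^*$ choice number $ch^*_{CF}(\mathcal{H})$ (resp. CF choice number $ch_{CF}(\mathcal{H})$) is the minimum $k$ for which $\mathcal{H}$ is $k$-CF$^*$-choosable (resp. $k$-CF-choosable). $\ln$ is the natural logarithm. -}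

module Defs where

open import Data.Nat using (ℕ; zero; suc; _≤_; _<_)
open import Data.Fin using (Fin)
open import Data.Fin.Subset using (Subset; _∈_; Nonempty)
open import Data.List using (List)
open import Data.List.Relation.Unary.All using (All)
open import Data.Maybe using (Maybe; just; nothing)
open import Data.Product using (Σ; ∃; ∃-syntax; _×_)
open import Relation.Binary.PropositionalEquality using (_≡_; _≢_)
open import Relation.Nullary using (¬_)
open import Function.Definitions using (Injective)

record Hypergraph (n : ℕ) : Set where
  constructor hypergraph
  field
    edges    : List (Subset n)
    nonempty : All Nonempty edges
open Hypergraph public

-- Colors are natural numbers.  A k-assignment gives each vertex v a set L_v of
-- exactly k colors, represented as an injective enumeration Fin k → ℕ.
record Assignment (n k : ℕ) : Set where
  constructor assignment
  field
    list     : Fin n → Fin k → ℕ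
    distinct : ∀ v → Injective _≡_ _≡_ (list v)
open Assignment public

InList : ∀ {n k} → Assignment n k → Fin n → ℕ → Set
InList L v c = ∃[ i ] list L v i ≡ c

PartialColoring : ℕ → Set
PartialColoring n = Fin n → Maybe ℕ

Respects : ∀ {n k} → Assignment n k → PartialColoring n → Set
Respects L f = ∀ v c → f v ≡ just c → InList L v c

Total : ∀ {n} → PartialColoring n → Set
Total f = ∀ v → ∃[ c ] f v ≡ just c

ConflictFreeEdge : ∀ {n} → PartialColoring n → Subset n → Set
ConflictFreeEdge f e =
  ∃[ v ] ∃[ c ] (v ∈ e × f v ≡ just c ×
    (∀ u → u ∈ e → u ≢ v → f u ≢ just c))

ConflictFree : ∀ {n} → Hypergraph n → PartialColoring n → Set
ConflictFree H f = All (ConflictFreeEdge f) (edges H)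

IsCFStarColoring : ∀ {n k} → Hypergraph n → Assignment n k → PartialColoring n → Set
IsCFStarColoring H L f = Respects L f × ConflictFree H f

IsCFColoring : ∀ {n k} → Hypergraph n → Assignment n k → PartialColoring n → Set
IsCFColoring H L f = Respects L f × Total f × ConflictFree H f

CFStarChoosable : ∀ {n} → Hypergraph n → ℕ → Set
CFStarChoosable {n} H k = (L : Assignment n k) → ∃[ f ] IsCFStarColoring H L f

CFChoosable : ∀ {n} → Hypergraph n → ℕ → Set
CFChoosable {n} H k = (L : Assignment n k) → ∃[ f ] IsCFColoring H L f

IsLeastPositive : (ℕ → Set) → ℕ → Set
IsLeastPositive P c = 1 ≤ c × P c × (∀ k → 1 ≤ k → k < c → ¬ P k)

IsCFStarChoiceNumber : ∀ {n} → Hypergraph n → ℕ → Set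
IsCFStarChoiceNumber H = IsLeastPositive (CFStarChoosable H)

IsCFChoiceNumber : ∀ {n} → Hypergraph n → ℕ → Set
IsCFChoiceNumber H = IsLeastPositive (CFChoosable H)

-- Split the colours into red and blue so that every list L_v keeps at least k = ch*_CF(H)
-- red colours and at least one blue one.  An L′-CF*-colouring from the red parts of the lists,
-- completed by giving each uncoloured vertex a blue colour of its list, is an L-CF-colouring:
-- blue colours never meet red ones, so every hyperedge keeps its uniquely coloured vertex.
-- For lists of size K = 3(k + ⌈log₂ n⌉ + 2) a uniformly random split fails at a given vertex
-- with probability at most 2^-K + 2^k (3/4)^K < 1/n, and a good split is found
-- deterministically by conditional expectations: deciding the colours one at a time, one of
-- the two choices never increases the expected number of failing vertices.

module Submission where

open import Defs
open import Data.Nat using (ℕ; _≤_; _<_; _+_; _*_)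
open import Data.Nat.Logarithm using (⌈log₂_⌉)
open import Data.Product using (Σ; ∃; ∃-syntax; _×_)

open import Data.Nat.Properties
open import Algebra.Properties.CommutativeSemigroup +-commutativeSemigroup using (interchange)
open import Algebra.Properties.CommutativeSemigroup *-commutativeSemigroup using (x∙yz≈y∙xz)
open import Algebra.Properties.Semiring.Sum +-*-semiring using (sum; sum-cong-≗; ∑-distrib-+; *-distribˡ-sum)
open import Algebra.Properties.Monoid.Sum *-1-monoid using ()
  renaming (sum to product; sum-cong-≗ to product-cong-≗)
open import Data.Bool using (Bool; true; false; if_then_else_)
open import Data.Empty using (⊥-elim)
open import Data.Fin using (Fin; zero; suc; combine; remQuot)
import Data.Fin.Properties as Finₚ
import Data.List.Relation.Unary.All as All
open import Data.Maybe using (Maybe; just; nothing; _<∣>_)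
open import Data.Maybe.Properties using (just-injective)
open import Data.Nat using (zero; suc; _^_; ⌊_/2⌋; ⌈_/2⌉; z≤n; s≤s; _≤?_; _≟_)
open import Data.Nat.Induction using (<-rec)
open import Data.Nat.Logarithm using (⌈log₂⌈n/2⌉⌉≡⌈log₂n⌉∸1)
open import Data.Nat.Solver using (module +-*-Solver)
open import Data.Product using (_,_; proj₁; proj₂; uncurry)
open import Data.Sum using (_⊎_; inj₁; inj₂; [_,_]′)
open import Data.Vec.Functional using (_∷_)
open import Function using (_∘_; id)
open import Function.Definitions using (Injective)
open import Relation.Binary.PropositionalEquality
open import Relation.Nullary using (Dec; yes; no)

open +-*-Solver using (solve; _:+_; _:*_; _:=_; con)

n≤2^⌈log₂n⌉ : ∀ n → n ≤ 2 ^ ⌈log₂ n ⌉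
n≤2^⌈log₂n⌉ = <-rec _ bound
  where
  bound : ∀ n → (∀ {m} → m < n → m ≤ 2 ^ ⌈log₂ m ⌉) → n ≤ 2 ^ ⌈log₂ n ⌉
  bound 0 _ = z≤n
  bound 1 _ = s≤s z≤n
  bound n@(suc (suc k)) rec = begin
    n                              ≡⟨ sym (⌊n/2⌋+⌈n/2⌉≡n n) ⟩
    ⌊ n /2⌋ + ⌈ n /2⌉              ≤⟨ +-monoˡ-≤ ⌈ n /2⌉ (⌊n/2⌋≤⌈n/2⌉ n) ⟩
    ⌈ n /2⌉ + ⌈ n /2⌉              ≡⟨ cong (⌈ n /2⌉ +_) (+-identityʳ ⌈ n /2⌉) ⟨
    2 * ⌈ n /2⌉                    ≤⟨ *-monoʳ-≤ 2 (rec (⌈n/2⌉<n k)) ⟩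
    2 ^ suc ⌈log₂ ⌈ n /2⌉ ⌉        ≡⟨ cong (λ l → 2 ^ suc l) (⌈log₂⌈n/2⌉⌉≡⌈log₂n⌉∸1 n) ⟩
    2 ^ ⌈log₂ n ⌉                  ∎
    where open ≤-Reasoning

^-distribʳ-* : ∀ a b m → (a * b) ^ m ≡ a ^ m * b ^ m
^-distribʳ-* a b zero    = refl
^-distribʳ-* a b (suc m) = begin
  a * b * (a * b) ^ m      ≡⟨ cong (a * b *_) (^-distribʳ-* a b m) ⟩
  a * b * (a ^ m * b ^ m)  ≡⟨ [m*n]*[o*p]≡[m*o]*[n*p] a b (a ^ m) (b ^ m) ⟩
  a ^ suc m * b ^ suc m    ∎
  where open ≡-Reasoning

x*[8^m+27^m]<64^m : ∀ x m → 4 * x ≤ 2 ^ suc m → x * (8 ^ suc m + 27 ^ suc m) < 64 ^ suc m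
x*[8^m+27^m]<64^m x m 4x≤2^M = *-cancelˡ-< 4 _ _ (begin-strict
  4 * (x * (8 ^ M + 27 ^ M))         ≡⟨ *-assoc 4 x _ ⟨
  4 * x * (8 ^ M + 27 ^ M)           ≤⟨ *-monoˡ-≤ _ 4x≤2^M ⟩
  2 ^ M * (8 ^ M + 27 ^ M)           ≡⟨ *-distribˡ-+ (2 ^ M) _ _ ⟩
  2 ^ M * 8 ^ M + 2 ^ M * 27 ^ M     ≡⟨ cong₂ _+_ (^-distribʳ-* 2 8 M) (^-distribʳ-* 2 27 M) ⟨
  16 ^ M + 54 ^ M                    <⟨ +-mono-≤-< (^-monoˡ-≤ M (m≤m+n 16 48))
                                                      (^-monoˡ-< M (m≤m+n 55 9)) ⟩
  64 ^ M + 64 ^ M                    ≡⟨ cong (64 ^ M +_) (+-identityʳ (64 ^ M)) ⟨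
  2 * 64 ^ M                         ≤⟨ *-monoˡ-≤ (64 ^ M) (m≤m+n 2 2) ⟩
  4 * 64 ^ M                         ∎)
  where
  M : ℕ
  M = suc m
  open ≤-Reasoning

-- With K = 3m the powers 2^K, 3^K, 4^K are 8^m, 27^m, 64^m; as 2 · 27 < 64, taking
-- 2^m ≥ 4 n 2^k suffices.
n*[2^K+2^k*3^K]<4^K : ∀ n k l → n ≤ 2 ^ l →
                      let K = 3 * (2 + k + l) in n * (2 ^ K + 2 ^ k * 3 ^ K) < 4 ^ K
n*[2^K+2^k*3^K]<4^K n k l n≤2^l = begin-strict
  n * (2 ^ K + 2 ^ k * 3 ^ K)          ≤⟨ *-monoʳ-≤ n (+-monoˡ-≤ _ 2^K≤2^k*2^K) ⟩
  n * (2 ^ k * 2 ^ K + 2 ^ k * 3 ^ K)  ≡⟨ cong (n *_) (*-distribˡ-+ (2 ^ k) _ _) ⟨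
  n * (2 ^ k * (2 ^ K + 3 ^ K))        ≡⟨ *-assoc n _ _ ⟨
  n * 2 ^ k * (2 ^ K + 3 ^ K)          ≡⟨ cong₂ (λ a b → n * 2 ^ k * (a + b))
                                                 (^-*-assoc 2 3 M) (^-*-assoc 3 3 M) ⟨
  n * 2 ^ k * (8 ^ M + 27 ^ M)         <⟨ x*[8^m+27^m]<64^m (n * 2 ^ k) (suc (k + l)) 4n2^k≤2^M ⟩
  64 ^ M                               ≡⟨ ^-*-assoc 4 3 M ⟩
  4 ^ K                                ∎
  where
  M K : ℕ
  M = 2 + k + l
  K = 3 * M
  open ≤-Reasoning
  2^K≤2^k*2^K : 2 ^ K ≤ 2 ^ k * 2 ^ K
  2^K≤2^k*2^K = m≤n*m (2 ^ K) (2 ^ k) {{m^n≢0 2 k}}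
  4n2^k≤2^M : 4 * (n * 2 ^ k) ≤ 2 ^ M
  4n2^k≤2^M = begin
    4 * (n * 2 ^ k)        ≤⟨ *-monoʳ-≤ 4 (*-monoˡ-≤ (2 ^ k) n≤2^l) ⟩
    4 * (2 ^ l * 2 ^ k)    ≡⟨ cong (4 *_) (*-comm (2 ^ l) (2 ^ k)) ⟩
    4 * (2 ^ k * 2 ^ l)    ≡⟨ cong (4 *_) (^-distribˡ-+-* 2 k l) ⟨
    4 * 2 ^ (k + l)        ≡⟨ ^-distribˡ-+-* 2 2 (k + l) ⟨
    2 ^ M                  ∎

3*[2+k+l]≤9*[k+l] : ∀ {k} l → 1 ≤ k → 3 * (2 + k + l) ≤ 9 * (k + l)
3*[2+k+l]≤9*[k+l] {suc k} l _ = begin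
  3 * (3 + k + l)                ≤⟨ m≤m+n _ (6 * (k + l)) ⟩
  3 * (3 + k + l) + 6 * (k + l)  ≡⟨ solve 2 (λ k l → con 3 :* (con 3 :+ k :+ l) :+ con 6 :* (k :+ l)
                                                  := con 9 :* (con 1 :+ k :+ l)) refl k l ⟩
  9 * (1 + k + l)                ∎
  where open ≤-Reasoning

m+n≡2*o⇒m≤o⊎n≤o : ∀ m n o → m + n ≡ 2 * o → m ≤ o ⊎ n ≤ o
m+n≡2*o⇒m≤o⊎n≤o m n o eq with m ≤? o
... | yes m≤o = inj₁ m≤o
... | no  m≰o = inj₂ (<⇒≤ (+-cancelˡ-< o n o (begin-strict
  o + n  <⟨ +-monoˡ-< n (≰⇒> m≰o) ⟩
  m + n  ≡⟨ eq ⟩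
  2 * o  ≡⟨ cong (o +_) (+-identityʳ o) ⟩
  o + o  ∎)))
  where open ≤-Reasoning

isLeastPositive⇒≤ : ∀ {P : ℕ → Set} {c k} → IsLeastPositive P c → 1 ≤ k → P k → c ≤ k
isLeastPositive⇒≤ {k = k} (_ , _ , least) 1≤k Pk = ≮⇒≥ (λ k<c → least k 1≤k k<c Pk)

sum-const : ∀ m c → sum {m} (λ _ → c) ≡ m * c
sum-const zero    c = refl
sum-const (suc m) c = cong (c +_) (sum-const m c)

product-const : ∀ m c → product {m} (λ _ → c) ≡ c ^ m
product-const zero    c = refl
product-const (suc m) c = cong (c *_) (product-const m c)

≤-sum : ∀ {m} (f : Fin m → ℕ) i → f i ≤ sum f
≤-sum f zero    = m≤m+n (f zero) _
≤-sum f (suc i) = m≤n⇒m≤o+n (f zero) (≤-sum (f ∘ suc) i)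

count : ∀ {m} → (Fin m → Bool) → ℕ
count p = sum (λ i → if p i then 1 else 0)

∷-injective : ∀ {A : Set} {k} {x : A} {g : Fin k → A} →
              (∀ j → g j ≢ x) → Injective _≡_ _≡_ g → Injective _≡_ _≡_ (x ∷ g)
∷-injective x∉g g-inj {zero}  {zero}  _  = refl
∷-injective x∉g g-inj {zero}  {suc j} eq = ⊥-elim (x∉g j (sym eq))
∷-injective x∉g g-inj {suc i} {zero}  eq = ⊥-elim (x∉g i eq)
∷-injective x∉g g-inj {suc i} {suc j} eq = cong suc (g-inj eq)

select : ∀ {m k} (p : Fin m → Bool) → k ≤ count p →
         Σ (Fin k → Fin m) λ ι → Injective _≡_ _≡_ ι × (∀ j → p (ι j) ≡ true)
select {k = zero} p _ = (λ ()) , (λ { {()} }) , λ ()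
select {m = zero}  {suc k} p ()
select {m = suc m} {suc k} p k≤ with p zero in p₀ | k≤
... | false | k≤′ =
  let ι , ι-inj , ι-sel = select (p ∘ suc) k≤′
  in  suc ∘ ι , ι-inj ∘ Finₚ.suc-injective , ι-sel
... | true  | s≤s k≤′ =
  let ι , ι-inj , ι-sel = select (p ∘ suc) k≤′
  in  zero ∷ suc ∘ ι , ∷-injective (λ _ ()) (ι-inj ∘ Finₚ.suc-injective) ,
      λ { zero → p₀ ; (suc j) → ι-sel j }

-- Partial red/blue splits and conditional expectations

data Side : Set where
  red blue : Side

Split : Set
Split = ℕ → Maybe Side

_[_≔_] : Split → ℕ → Side → Split
(σ [ c ≔ s ]) d with d ≟ c
... | yes _ = just s
... | no  _ = σ d

[≔]-updated : ∀ σ c s → (σ [ c ≔ s ]) c ≡ just s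
[≔]-updated σ c s with c ≟ c
... | yes _   = refl
... | no  c≢c = ⊥-elim (c≢c refl)

[≔]-unchanged : ∀ σ {c d} s → d ≢ c → (σ [ c ≔ s ]) d ≡ σ d
[≔]-unchanged σ {c} {d} s d≢c with d ≟ c
... | yes d≡c = ⊥-elim (d≢c d≡c)
... | no  _   = refl

Decided : Split → ℕ → Set
Decided σ c = ∃[ s ] σ c ≡ just s

_⊑_ : Split → Split → Set
σ ⊑ τ = ∀ {c} → Decided σ c → Decided τ c

⊑-[≔] : ∀ σ c s → σ ⊑ (σ [ c ≔ s ])
⊑-[≔] σ c s {d} decided with d ≟ c
... | yes _ = s , refl
... | no  _ = decided

AveragingAt : ℕ → (Split → ℕ) → Set
AveragingAt c Φ = ∀ σ → σ c ≡ nothing → Φ (σ [ c ≔ red ]) + Φ (σ [ c ≔ blue ]) ≡ 2 * Φ σ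

IndependentOf : ℕ → (Split → ℕ) → Set
IndependentOf c Φ = ∀ σ s → Φ (σ [ c ≔ s ]) ≡ Φ σ

module _ {c : ℕ} {Φ Ψ : Split → ℕ} where

  averagingAt-+ : AveragingAt c Φ → AveragingAt c Ψ → AveragingAt c (λ σ → Φ σ + Ψ σ)
  averagingAt-+ avgΦ avgΨ σ σc = begin
    (Φ σ₀ + Ψ σ₀) + (Φ σ₁ + Ψ σ₁)  ≡⟨ interchange (Φ σ₀) (Ψ σ₀) (Φ σ₁) (Ψ σ₁) ⟩
    (Φ σ₀ + Φ σ₁) + (Ψ σ₀ + Ψ σ₁)  ≡⟨ cong₂ _+_ (avgΦ σ σc) (avgΨ σ σc) ⟩
    2 * Φ σ + 2 * Ψ σ              ≡⟨ *-distribˡ-+ 2 (Φ σ) (Ψ σ) ⟨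
    2 * (Φ σ + Ψ σ)                ∎
    where
    open ≡-Reasoning
    σ₀ σ₁ : Split
    σ₀ = σ [ c ≔ red ]
    σ₁ = σ [ c ≔ blue ]

  averagingAt-*ʳ : AveragingAt c Φ → IndependentOf c Ψ → AveragingAt c (λ σ → Φ σ * Ψ σ)
  averagingAt-*ʳ avg ind σ σc = begin
    Φ σ₀ * Ψ σ₀ + Φ σ₁ * Ψ σ₁  ≡⟨ cong₂ (λ x y → Φ σ₀ * x + Φ σ₁ * y) (ind σ red) (ind σ blue) ⟩
    Φ σ₀ * Ψ σ + Φ σ₁ * Ψ σ    ≡⟨ *-distribʳ-+ (Ψ σ) (Φ σ₀) (Φ σ₁) ⟨
    (Φ σ₀ + Φ σ₁) * Ψ σ        ≡⟨ cong (_* Ψ σ) (avg σ σc) ⟩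
    2 * Φ σ * Ψ σ              ≡⟨ *-assoc 2 (Φ σ) (Ψ σ) ⟩
    2 * (Φ σ * Ψ σ)            ∎
    where
    open ≡-Reasoning
    σ₀ σ₁ : Split
    σ₀ = σ [ c ≔ red ]
    σ₁ = σ [ c ≔ blue ]

  averagingAt-*ˡ : IndependentOf c Ψ → AveragingAt c Φ → AveragingAt c (λ σ → Ψ σ * Φ σ)
  averagingAt-*ˡ ind avg σ σc = begin
    Ψ σ₀ * Φ σ₀ + Ψ σ₁ * Φ σ₁  ≡⟨ cong₂ (λ x y → x * Φ σ₀ + y * Φ σ₁) (ind σ red) (ind σ blue) ⟩
    Ψ σ * Φ σ₀ + Ψ σ * Φ σ₁    ≡⟨ *-distribˡ-+ (Ψ σ) (Φ σ₀) (Φ σ₁) ⟨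
    Ψ σ * (Φ σ₀ + Φ σ₁)        ≡⟨ cong (Ψ σ *_) (avg σ σc) ⟩
    Ψ σ * (2 * Φ σ)            ≡⟨ x∙yz≈y∙xz (Ψ σ) 2 (Φ σ) ⟩
    2 * (Ψ σ * Φ σ)            ∎
    where
    open ≡-Reasoning
    σ₀ σ₁ : Split
    σ₀ = σ [ c ≔ red ]
    σ₁ = σ [ c ≔ blue ]

averagingAt-sum : ∀ {c m} (Φ : Fin m → Split → ℕ) → (∀ i → AveragingAt c (Φ i)) →
                  AveragingAt c (λ σ → sum (λ i → Φ i σ))
averagingAt-sum {c} Φ avg σ σc = begin
  sum (λ i → Φ i (σ [ c ≔ red ])) + sum (λ i → Φ i (σ [ c ≔ blue ]))
    ≡⟨ ∑-distrib-+ (λ i → Φ i (σ [ c ≔ red ])) _ ⟨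
  sum (λ i → Φ i (σ [ c ≔ red ]) + Φ i (σ [ c ≔ blue ]))
    ≡⟨ sum-cong-≗ (λ i → avg i σ σc) ⟩
  sum (λ i → 2 * Φ i σ)
    ≡⟨ *-distribˡ-sum 2 (λ i → Φ i σ) ⟨
  2 * sum (λ i → Φ i σ) ∎
  where open ≡-Reasoning

independent⇒averagingAt : ∀ {c Φ} → IndependentOf c Φ → AveragingAt c Φ
independent⇒averagingAt ind σ _ = cong₂ _+_ (ind σ red) (trans (ind σ blue) (sym (+-identityʳ _)))

independentOf-product : ∀ {c m} (Φ : Fin m → Split → ℕ) → (∀ i → IndependentOf c (Φ i)) →
                        IndependentOf c (λ σ → product (λ i → Φ i σ))
independentOf-product Φ ind σ s = product-cong-≗ (λ i → ind i σ s)

module _ {Φ : Split → ℕ} (averaging : ∀ c → AveragingAt c Φ) where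

  decide : ∀ c σ → ∃[ τ ] Φ τ ≤ Φ σ × σ ⊑ τ × Decided τ c
  decide c σ with σ c in σc
  ... | just s  = σ , ≤-refl , id , s , σc
  ... | nothing with m+n≡2*o⇒m≤o⊎n≤o _ _ _ (averaging c σ σc)
  ...   | inj₁ ≤Φσ = σ [ c ≔ red ]  , ≤Φσ , ⊑-[≔] σ c red  , red  , [≔]-updated σ c red
  ...   | inj₂ ≤Φσ = σ [ c ≔ blue ] , ≤Φσ , ⊑-[≔] σ c blue , blue , [≔]-updated σ c blue

  decideAll : ∀ {m} (cs : Fin m → ℕ) σ → ∃[ τ ] Φ τ ≤ Φ σ × (∀ i → Decided τ (cs i))
  decideAll {zero}  cs σ = σ , ≤-refl , λ ()
  decideAll {suc m} cs σ with decideAll (cs ∘ suc) σ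
  ... | τ , Φτ≤Φσ , decided with decide (cs zero) τ
  ... | υ , Φυ≤Φτ , τ⊑υ , decided₀ = υ , ≤-trans Φυ≤Φτ Φτ≤Φσ , λ where
    zero    → decided₀
    (suc i) → τ⊑υ (decided i)

-- The potential

Balanced : (Maybe Side → ℕ) → Set
Balanced w = w (just red) + w (just blue) ≡ 2 * w nothing

weight : ∀ {K} → (Maybe Side → ℕ) → Split → (Fin K → ℕ) → ℕ
weight w σ ℓ = product (λ i → w (σ (ℓ i)))

weight-averagingAt : ∀ {K} w → Balanced w → (ℓ : Fin K → ℕ) → Injective _≡_ _≡_ ℓ →
                     ∀ c → AveragingAt c (λ σ → weight w σ ℓ)
weight-averagingAt {zero}  w balanced ℓ ℓ-inj c = independent⇒averagingAt {Φ = λ _ → 1} (λ _ _ → refl)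
weight-averagingAt {suc K} w balanced ℓ ℓ-inj c = by-cases (ℓ zero ≟ c)
  where
  first rest : Split → ℕ
  first σ = w (σ (ℓ zero))
  rest  σ = weight w σ (ℓ ∘ suc)
  factor-independent : ∀ {c′ d} → d ≢ c′ → IndependentOf c′ (λ σ → w (σ d))
  factor-independent d≢c′ σ s = cong w ([≔]-unchanged σ s d≢c′)
  first-averaging : AveragingAt (ℓ zero) first
  first-averaging σ σc
    rewrite [≔]-updated σ (ℓ zero) red | [≔]-updated σ (ℓ zero) blue | σc = balanced
  rest-independent : IndependentOf (ℓ zero) rest
  rest-independent = independentOf-product (λ i σ → w (σ (ℓ (suc i))))
    λ i → factor-independent (Finₚ.0≢1+n ∘ ℓ-inj ∘ sym)
  -- A `with` on ℓ zero ≟ c would also rewrite the same test inside (σ [ c ≔ s ]) (ℓ zero).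
  by-cases : Dec (ℓ zero ≡ c) → AveragingAt c (λ σ → weight w σ ℓ)
  by-cases (yes ℓ₀≡c) = subst (λ c → AveragingAt c (λ σ → weight w σ ℓ)) ℓ₀≡c
    (averagingAt-*ʳ {Φ = first} {Ψ = rest} first-averaging rest-independent)
  by-cases (no ℓ₀≢c)  = averagingAt-*ˡ {Φ = rest} {Ψ = first} (factor-independent ℓ₀≢c)
    (weight-averagingAt w balanced (ℓ ∘ suc) (Finₚ.suc-injective ∘ ℓ-inj) c)

-- With the undecided colours split uniformly at random, weight allRedWeight σ ℓ is 4^K times
-- the probability that all of ℓ is red, and weight fewRedWeight σ ℓ is 4^K times the expectation
-- of 2^-r, r the number of red colours of ℓ; by Markov, 2^k times the latter bounds P(r < k).
allRedWeight : Maybe Side → ℕ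
allRedWeight nothing     = 2
allRedWeight (just red)  = 4
allRedWeight (just blue) = 0

fewRedWeight : Maybe Side → ℕ
fewRedWeight nothing     = 3
fewRedWeight (just red)  = 2
fewRedWeight (just blue) = 4

isRed : Maybe Side → Bool
isRed (just red) = true
isRed _          = false

isRed⇒≡red : ∀ s → isRed s ≡ true → s ≡ just red
isRed⇒≡red (just red) _ = refl

redCount : ∀ {K} → Split → (Fin K → ℕ) → ℕ
redCount σ ℓ = count (isRed ∘ σ ∘ ℓ)

allRed-decided : ∀ {K} σ (ℓ : Fin K → ℕ) → (∀ i → Decided σ (ℓ i)) →
                 (∃[ i ] σ (ℓ i) ≡ just blue) ⊎ weight allRedWeight σ ℓ ≡ 4 ^ K
allRed-decided {zero}  σ ℓ _ = inj₂ refl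
allRed-decided {suc K} σ ℓ decided with decided zero | allRed-decided σ (ℓ ∘ suc) (decided ∘ suc)
... | blue , σℓ₀ | _             = inj₁ (zero , σℓ₀)
... | red  , _   | inj₁ (i , σℓᵢ) = inj₁ (suc i , σℓᵢ)
... | red  , σℓ₀ | inj₂ eq        = inj₂ (cong₂ _*_ (cong allRedWeight σℓ₀) eq)

fewRed-decided : ∀ {K} σ (ℓ : Fin K → ℕ) → (∀ i → Decided σ (ℓ i)) →
                 weight fewRedWeight σ ℓ * 2 ^ redCount σ ℓ ≡ 4 ^ K
fewRed-decided {zero}  σ ℓ _ = refl
fewRed-decided {suc K} σ ℓ decided with decided zero | fewRed-decided σ (ℓ ∘ suc) (decided ∘ suc)
... | red  , σℓ₀ | eq rewrite σℓ₀ =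
  trans ([m*n]*[o*p]≡[m*o]*[n*p] 2 (weight fewRedWeight σ (ℓ ∘ suc)) 2 _) (cong (4 *_) eq)
... | blue , σℓ₀ | eq rewrite σℓ₀ =
  trans (*-assoc 4 (weight fewRedWeight σ (ℓ ∘ suc)) _) (cong (4 *_) eq)

vertexPotential : ∀ {K} → ℕ → Split → (Fin K → ℕ) → ℕ
vertexPotential k σ ℓ = weight allRedWeight σ ℓ + 2 ^ k * weight fewRedWeight σ ℓ

potential : ∀ {n K} → Assignment n K → ℕ → Split → ℕ
potential L k σ = sum (λ v → vertexPotential k σ (list L v))

potential-averagingAt : ∀ {n K} (L : Assignment n K) k c → AveragingAt c (potential L k)
potential-averagingAt L k c = averagingAt-sum (λ v σ → vertexPotential k σ (list L v)) λ v →
  averagingAt-+ {Φ = allRed v} {Ψ = λ σ → 2 ^ k * fewRed v σ}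
    (weight-averagingAt allRedWeight refl (list L v) (distinct L v) c)
    (averagingAt-*ˡ {Φ = fewRed v} {Ψ = λ _ → 2 ^ k} (λ _ _ → refl)
      (weight-averagingAt fewRedWeight refl (list L v) (distinct L v) c))
  where
  allRed fewRed : _ → Split → ℕ
  allRed v σ = weight allRedWeight σ (list L v)
  fewRed v σ = weight fewRedWeight σ (list L v)

potential-undecided : ∀ {n K} (L : Assignment n K) k →
                      potential L k (λ _ → nothing) ≡ n * (2 ^ K + 2 ^ k * 3 ^ K)
potential-undecided {n} {K} L k = trans
  (sum-cong-≗ {n} λ v → cong₂ (λ a b → a + 2 ^ k * b) (product-const K 2) (product-const K 3))
  (sum-const n (2 ^ K + 2 ^ k * 3 ^ K))

RedBlue : ∀ {K} → ℕ → Split → (Fin K → ℕ) → Set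
RedBlue k σ ℓ = (∃[ i ] σ (ℓ i) ≡ just blue) × k ≤ redCount σ ℓ

light⇒redBlue : ∀ {K} k σ (ℓ : Fin K → ℕ) → (∀ i → Decided σ (ℓ i)) →
                vertexPotential k σ ℓ < 4 ^ K → RedBlue k σ ℓ
light⇒redBlue {K} k σ ℓ decided light = has-blue , has-reds
  where
  open ≤-Reasoning
  A F : ℕ
  A = weight allRedWeight σ ℓ
  F = weight fewRedWeight σ ℓ
  has-blue : ∃[ i ] σ (ℓ i) ≡ just blue
  has-blue with allRed-decided σ ℓ decided
  ... | inj₁ blue∈ℓ = blue∈ℓ
  ... | inj₂ A≡4^K  = ⊥-elim (<⇒≱ light (begin
    4 ^ K      ≡⟨ A≡4^K ⟨
    A          ≤⟨ m≤m+n A _ ⟩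
    vertexPotential k σ ℓ ∎))
  has-reds : k ≤ redCount σ ℓ
  has-reds = ≮⇒≥ λ few → <⇒≱ light (begin
    4 ^ K                   ≡⟨ fewRed-decided σ ℓ decided ⟨
    F * 2 ^ redCount σ ℓ    ≤⟨ *-monoʳ-≤ F (^-monoʳ-≤ 2 (<⇒≤ few)) ⟩
    F * 2 ^ k               ≡⟨ *-comm F (2 ^ k) ⟩
    2 ^ k * F               ≤⟨ m≤n+m _ A ⟩
    vertexPotential k σ ℓ   ∎)

redBlueSplit : ∀ {n K} (L : Assignment n K) k → n * (2 ^ K + 2 ^ k * 3 ^ K) < 4 ^ K →
               ∃[ σ ] ∀ v → RedBlue k σ (list L v)
redBlueSplit {n} {K} L k bound
  with decideAll (potential-averagingAt L k) (uncurry (list L) ∘ remQuot K) (λ _ → nothing)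
... | σ , Φσ≤ , decided = σ , λ v → light⇒redBlue k σ (list L v) (decided′ v) (light v)
  where
  decided′ : ∀ v i → Decided σ (list L v i)
  decided′ v i = subst (Decided σ ∘ uncurry (list L)) (Finₚ.remQuot-combine v i) (decided (combine v i))
  light : ∀ v → vertexPotential k σ (list L v) < 4 ^ K
  light v = begin-strict
    vertexPotential k σ (list L v)        ≤⟨ ≤-sum (λ v → vertexPotential k σ (list L v)) v ⟩
    potential L k σ                       ≤⟨ Φσ≤ ⟩
    potential L k (λ _ → nothing)         ≡⟨ potential-undecided L k ⟩
    n * (2 ^ K + 2 ^ k * 3 ^ K)           <⟨ bound ⟩
    4 ^ K                                 ∎
    where open ≤-Reasoning

-- Completing a CF*-colouring

fill : ∀ {n} → PartialColoring n → (Fin n → ℕ) → PartialColoring n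
fill f b v = f v <∣> just (b v)

fill-just : ∀ {n} (f : PartialColoring n) b v {c} → fill f b v ≡ just c → f v ≡ just c ⊎ b v ≡ c
fill-just f b v eq with f v
... | just _  = inj₁ eq
... | nothing = inj₂ (just-injective eq)

fill-total : ∀ {n} (f : PartialColoring n) b → Total (fill f b)
fill-total f b v with f v
... | just c  = c , refl
... | nothing = b v , refl

fill-conflictFree : ∀ {n} {H : Hypergraph n} (f : PartialColoring n) b →
                    (∀ u v {c} → f v ≡ just c → b u ≢ c) → ConflictFree H f → ConflictFree H (fill f b)
fill-conflictFree f b disjoint = All.map edge
  where
  edge : ∀ {e} → ConflictFreeEdge f e → ConflictFreeEdge (fill f b) e
  edge (v , c , v∈e , fv≡c , unique) = v , c , v∈e , cong (_<∣> just (b v)) fv≡c ,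
    λ u u∈e u≢v fill-u≡c → [ unique u u∈e u≢v , disjoint u v fv≡c ]′ (fill-just f b u fill-u≡c)

fill-isCFColoring : ∀ {n k K} {H : Hypergraph n} {L : Assignment n K} {L′ : Assignment n k} f b →
                    (∀ v c → InList L′ v c → InList L v c) → (∀ v → InList L v (b v)) →
                    (∀ u v c → InList L′ v c → b u ≢ c) →
                    IsCFStarColoring H L′ f → IsCFColoring H L (fill f b)
fill-isCFColoring {H = H} {L = L} f b L′⊆L b∈L disjoint (respects , conflictFree) =
  respects′ , fill-total f b ,
  fill-conflictFree {H = H} f b (λ u v fv≡c → disjoint u v _ (respects v _ fv≡c)) conflictFree
  where
  respects′ : Respects L (fill f b)
  respects′ v c fill-v≡c with fill-just f b v fill-v≡c
  ... | inj₁ fv≡c = L′⊆L v c (respects v c fv≡c)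
  ... | inj₂ refl = b∈L v

redSubassignment : ∀ {n K k} (L : Assignment n K) σ → (∀ v → k ≤ redCount σ (list L v)) →
                   Σ (Assignment n k) λ L′ → ∀ v c → InList L′ v c → InList L v c × σ c ≡ just red
redSubassignment {n} {K} {k} L σ enough = L′ , L′-red
  where
  reds : ∀ v → Σ (Fin k → Fin K) λ ι →
                 Injective _≡_ _≡_ ι × (∀ j → isRed (σ (list L v (ι j))) ≡ true)
  reds v = select (isRed ∘ σ ∘ list L v) (enough v)
  L′ : Assignment n k
  L′ = assignment (λ v → list L v ∘ proj₁ (reds v)) (λ v → proj₁ (proj₂ (reds v)) ∘ distinct L v)
  L′-red : ∀ v c → InList L′ v c → InList L v c × σ c ≡ just red
  L′-red v c (j , ℓιj≡c) =
    (proj₁ (reds v) j , ℓιj≡c) ,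
    subst (λ d → σ d ≡ just red) ℓιj≡c (isRed⇒≡red _ (proj₂ (proj₂ (reds v)) j))

cfChoosable : ∀ {n} (H : Hypergraph n) {k K} → n * (2 ^ K + 2 ^ k * 3 ^ K) < 4 ^ K →
              CFStarChoosable H k → CFChoosable H K
cfChoosable {n} H {k} {K} bound cfStarChoosable L with redBlueSplit L k bound
... | σ , redBlue with redSubassignment L σ (λ v → proj₂ (redBlue v))
... | L′ , L′-red with cfStarChoosable L′
... | f , isCFStar =
  fill f blueColour ,
  fill-isCFColoring {H = H} {L = L} {L′ = L′} f blueColour
    (λ v c → proj₁ ∘ L′-red v c) (λ v → _ , refl) disjoint isCFStar
  where
  blueColour : Fin n → ℕ
  blueColour v = list L v (proj₁ (proj₁ (redBlue v)))
  disjoint : ∀ u v c → InList L′ v c → blueColour u ≢ c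
  disjoint u v c c∈L′ refl with trans (sym (proj₂ (proj₁ (redBlue u)))) (proj₂ (L′-red v c c∈L′))
  ... | ()

theorem5 : ∃[ C ] (0 < C × (∀ n (H : Hypergraph n) (ch ch* : ℕ) →
             IsCFChoiceNumber H ch → IsCFStarChoiceNumber H ch* →
             ch ≤ C * (ch* + ⌈log₂ n ⌉)))
theorem5 = 9 , s≤s z≤n , ch≤9*[ch*+⌈log₂n⌉]
  where
  ch≤9*[ch*+⌈log₂n⌉] : ∀ n (H : Hypergraph n) ch ch* → IsCFChoiceNumber H ch →
                       IsCFStarChoiceNumber H ch* → ch ≤ 9 * (ch* + ⌈log₂ n ⌉)
  ch≤9*[ch*+⌈log₂n⌉] n H ch ch* isCh (1≤ch* , cfStarChoosable , _) = begin
    ch                           ≤⟨ isLeastPositive⇒≤ isCh (s≤s z≤n) (cfChoosable H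
                                      (n*[2^K+2^k*3^K]<4^K n ch* ⌈log₂ n ⌉ (n≤2^⌈log₂n⌉ n))
                                      cfStarChoosable) ⟩
    3 * (2 + ch* + ⌈log₂ n ⌉)    ≤⟨ 3*[2+k+l]≤9*[k+l] ⌈log₂ n ⌉ 1≤ch* ⟩
    9 * (ch* + ⌈log₂ n ⌉)        ∎
    where open ≤-Reasoning
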